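{- For all formulas $A_1,X_1,\dots,A_n,X_n,B,Y$: the I/O sequent $(A_1,X_1),\dots,(A_n,X_n)\vdash(B,Y)$ is derivable in $\mathbf{C}_4$ iff for every partition $(I,J)\in\mathcal{P}(\{1,\dots,n\})$, either the LK sequent $B,\{X_j\}_{j\in J}\Rightarrow\{A_i\}_{i\in I}$ or the LK sequent $\{X_j\}_{j\in J}\Rightarrow Y$ is derivable in LK.
   Context: Formulas are classical propositional formulas; $\models$ is classical entailment. An LK sequent $\Gamma\Rightarrow\Delta$ is derivable in LK iff $\bigwedge\Gamma\models\bigvee\Delta$ (empty conjunction $=\top$, empty disjunction $=\bot$). An I/O pair is an ordered pair $(A,X)$ of formulas; an I/O sequent has the form $G\vdash(B,Y)$ with $G$ a finite multiset of pairs. The calculus $\mathbf{C}_4$ has the rules: (IN) from $B\Rightarrow$ infer $G\vdash(B,Y)$; (OUT) from $\Rightarrow Y$ infer $G\vdash(B,Y)$; (E4) from $G\vdash(B\wedge\neg A,Y)$ and $G\vdash(B\wedge X,Y\vee\neg X)$ infer $(A,X),G\vdash(B,Y)$. An I/O sequent is derivable in $\mathbf{C}_4$ if it is the root of a finite tree built with these rules in which every LK-sequent premise is derivable in LK. $\mathcal{P}(S)$ denotes the set of pairs $(I,J)$ with $I\cup J=S$ and $I\cap J=\emptyset$. -}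

module Defs where

open import Data.Nat using (ℕ)
open import Data.Bool using (Bool; true; false; _∧_; _∨_; not; if_then_else_)
open import Data.List using (List; []; _∷_; foldr; map)
open import Data.Fin using (Fin)
open import Data.List using (allFin)
open import Data.Product using (_×_; _,_)
open import Relation.Binary.PropositionalEquality using (_≡_)
open import Data.List.Relation.Binary.Permutation.Propositional using (_↭_)

data Formula : Set where
  atom : ℕ → Formula
  ⊤f ⊥f : Formula
  ¬f_ : Formula → Formula
  _∧f_ _∨f_ _⇒f_ : Formula → Formula → Formula

infix 30 ¬f_
infixr 20 _∧f_
infixr 19 _∨f_
infixr 18 _⇒f_

Valuation : Set
Valuation = ℕ → Bool

⟦_⟧ : Formula → Valuation → Bool
⟦ atom p ⟧ v = v p
⟦ ⊤f ⟧ v = true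
⟦ ⊥f ⟧ v = false
⟦ ¬f A ⟧ v = not (⟦ A ⟧ v)
⟦ A ∧f B ⟧ v = ⟦ A ⟧ v ∧ ⟦ B ⟧ v
⟦ A ∨f B ⟧ v = ⟦ A ⟧ v ∨ ⟦ B ⟧ v
⟦ A ⇒f B ⟧ v = not (⟦ A ⟧ v) ∨ ⟦ B ⟧ v

_⊨_ : Formula → Formula → Set
A ⊨ B = ∀ (v : Valuation) → ⟦ A ⟧ v ≡ true → ⟦ B ⟧ v ≡ true

⋀ : List Formula → Formula
⋀ = foldr _∧f_ ⊤f

⋁ : List Formula → Formula
⋁ = foldr _∨f_ ⊥f

-- LK sequent Γ ⇒ Δ; by the stated fact (soundness/completeness of LK),
-- it is derivable in LK iff ⋀Γ ⊨ ⋁Δ.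
record LKSequent : Set where
  constructor _⇒_
  field
    ant suc : List Formula

LK-derivable : LKSequent → Set
LK-derivable (Γ ⇒ Δ) = ⋀ Γ ⊨ ⋁ Δ

Pair : Set
Pair = Formula × Formula

-- Derivability of the I/O sequent  G ⊢ (B , Y)  in C₄.
-- G is a finite multiset of pairs, represented by a list; the principal pair of
-- (E4) may be any member, expressed via permutation (↭).
data C4⊢ : List Pair → Pair → Set where
  IN  : ∀ {G B Y} → LK-derivable ((B ∷ []) ⇒ []) → C4⊢ G (B , Y)
  OUT : ∀ {G B Y} → LK-derivable ([] ⇒ (Y ∷ [])) → C4⊢ G (B , Y)
  E4  : ∀ {G G' A X B Y} → G' ↭ ((A , X) ∷ G) →
        C4⊢ G (B ∧f ¬f A , Y) →
        C4⊢ G (B ∧f X , Y ∨f ¬f X) →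
        C4⊢ G' (B , Y)

pairs : ∀ n → (Fin n → Formula) → (Fin n → Formula) → List Pair
pairs n A X = map (λ i → (A i , X i)) (allFin n)

-- Given p : Fin n → Bool encoding the partition (I,J) ∈ 𝒫({1..n})
-- with I = {i | p i ≡ true}, J = {j | p j ≡ false}:
-- the list of f i for i ∈ I (select true) or for j ∈ J (select false).
select : ∀ {n} → Bool → (Fin n → Bool) → (Fin n → Formula) → List Formula
select {n} b p f = foldr (λ i acc → if eqb (p i) b then f i ∷ acc else acc) [] (allFin n)
  where
  eqb : Bool → Bool → Bool
  eqb true true = true
  eqb false false = true
  eqb _ _ = false

-- Both premises of (E4) come from its conclusion by invertible LK rules: putting the
-- principal pair (A , X) into I turns the succedent A into the antecedent ¬A, putting it
-- into J adds X to the antecedent and ¬X to the succedent. So the partition condition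
-- holds for the conclusion of (E4) iff it holds for both premises. It holds for every
-- conclusion of (IN) and (OUT), and with no pairs left it is exactly the disjunction of
-- their premises; induction on the list of pairs gives both directions.
module Submission where

open import Defs
open import Data.Nat using (ℕ; zero; suc)
open import Data.Fin using (Fin; zero; suc)
open import Data.Bool using (Bool; true; false; not; T; T?)
open import Data.Bool.Properties using (T-≡; T-∧; T-∨)
open import Data.Unit using (tt)
open import Data.List using (List; []; _∷_; foldr; map; tabulate; allFin)
open import Data.List.Properties using (map-tabulate; foldr-map)
open import Data.List.Relation.Unary.All using (All; []; _∷_)
open import Data.List.Relation.Unary.Any using (Any; here; there; toSum; fromSum)
import Data.List.Relation.Unary.Any as Any
open import Data.List.Relation.Binary.Subset.Propositional using (_⊆_)
open import Data.List.Relation.Binary.Subset.Propositional.Properties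
  using (Any-resp-⊆; All-resp-⊇; ⊆-refl; ⊆-reflexive-↭; ∷⁺ʳ)
open import Data.List.Relation.Binary.Permutation.Propositional
  using (_↭_; refl; prep; swap; trans; ↭-sym; ↭-trans)
open import Data.Vec.Functional using () renaming (_∷_ to _◂_)
open import Data.Product using (_×_; _,_; ∃-syntax)
import Data.Sum as Sum
open import Data.Sum.Function.Propositional using (_⊎-⇔_)
open import Data.Sum using (_⊎_; inj₁; inj₂; [_,_])
open import Function using (_∘_; const; id)
open import Function.Bundles using (_⇔_; mk⇔; Equivalence)
open import Function.Properties.Equivalence using () renaming (trans to ⇔-trans)
open import Relation.Nullary using (¬_; yes; no)
open import Relation.Binary.PropositionalEquality using (_≡_; refl; sym; cong; subst)
  renaming (trans to ≡-trans)

open Equivalence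

_⊩_ : Valuation → Formula → Set
v ⊩ φ = T (⟦ φ ⟧ v)

infix 4 _⊩_ _⊨*_

_⊨*_ : List Formula → List Formula → Set
Γ ⊨* Δ = ∀ v → All (v ⊩_) Γ → Any (v ⊩_) Δ

T-not⇔¬T : ∀ b → T (not b) ⇔ (¬ T b)
T-not⇔¬T true = mk⇔ (λ ()) (λ ¬t → ¬t tt)
T-not⇔¬T false = mk⇔ (λ _ ()) (const tt)

⊩-⋀ : ∀ {v} Γ → v ⊩ ⋀ Γ ⇔ All (v ⊩_) Γ
⊩-⋀ [] = mk⇔ (const []) (const tt)
⊩-⋀ {v} (φ ∷ Γ) = mk⇔
  (λ h → let (t , ts) = to (T-∧ {⟦ φ ⟧ v}) h in t ∷ to (⊩-⋀ Γ) ts)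
  (λ { (t ∷ ts) → from (T-∧ {⟦ φ ⟧ v}) (t , from (⊩-⋀ Γ) ts) })

⊩-⋁ : ∀ {v} Δ → v ⊩ ⋁ Δ ⇔ Any (v ⊩_) Δ
⊩-⋁ [] = mk⇔ (λ ()) (λ ())
⊩-⋁ {v} (φ ∷ Δ) = mk⇔
  (fromSum ∘ Sum.map₂ (to (⊩-⋁ Δ)) ∘ to (T-∨ {⟦ φ ⟧ v}))
  (from (T-∨ {⟦ φ ⟧ v}) ∘ Sum.map₂ (from (⊩-⋁ Δ)) ∘ toSum)

LK-derivable⇔⊨* : ∀ {Γ Δ} → LK-derivable (Γ ⇒ Δ) ⇔ Γ ⊨* Δ
LK-derivable⇔⊨* {Γ} {Δ} = mk⇔
  (λ d v → to (⊩-⋁ Δ) ∘ from T-≡ ∘ d v ∘ to T-≡ ∘ from (⊩-⋀ Γ))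
  (λ e v → to T-≡ ∘ from (⊩-⋁ Δ) ∘ e v ∘ to (⊩-⋀ Γ) ∘ from T-≡)

⊨*-weaken : ∀ {Γ Γ′ Δ Δ′} → Γ ⊆ Γ′ → Δ ⊆ Δ′ → Γ ⊨* Δ → Γ′ ⊨* Δ′
⊨*-weaken Γ⊆Γ′ Δ⊆Δ′ e v = Any-resp-⊆ Δ⊆Δ′ ∘ e v ∘ All-resp-⊇ Γ⊆Γ′

⊨*-resp-↭ : ∀ {Γ Γ′ Δ Δ′} → Γ ↭ Γ′ → Δ ↭ Δ′ → Γ ⊨* Δ → Γ′ ⊨* Δ′
⊨*-resp-↭ Γ↭Γ′ Δ↭Δ′ = ⊨*-weaken (⊆-reflexive-↭ Γ↭Γ′) (⊆-reflexive-↭ Δ↭Δ′)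

⊨*-swapˡ : ∀ {φ ψ Γ Δ} → (φ ∷ ψ ∷ Γ) ⊨* Δ ⇔ (ψ ∷ φ ∷ Γ) ⊨* Δ
⊨*-swapˡ = mk⇔ (⊨*-resp-↭ (swap _ _ refl) refl) (⊨*-resp-↭ (swap _ _ refl) refl)

⊨*-swapʳ : ∀ {φ ψ Γ Δ} → Γ ⊨* (φ ∷ ψ ∷ Δ) ⇔ Γ ⊨* (ψ ∷ φ ∷ Δ)
⊨*-swapʳ = mk⇔ (⊨*-resp-↭ refl (swap _ _ refl)) (⊨*-resp-↭ refl (swap _ _ refl))

All-⊩-∧ : ∀ {v φ ψ Γ} → All (v ⊩_) (φ ∧f ψ ∷ Γ) ⇔ All (v ⊩_) (φ ∷ ψ ∷ Γ)
All-⊩-∧ {v} {φ} = mk⇔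
  (λ { (tu ∷ ts) → let (t , u) = to (T-∧ {⟦ φ ⟧ v}) tu in t ∷ u ∷ ts })
  (λ { (t ∷ u ∷ ts) → from (T-∧ {⟦ φ ⟧ v}) (t , u) ∷ ts })

Any-⊩-∨ : ∀ {v φ ψ Δ} → Any (v ⊩_) (φ ∨f ψ ∷ Δ) ⇔ Any (v ⊩_) (φ ∷ ψ ∷ Δ)
Any-⊩-∨ {v} {φ} = mk⇔ to′ from′
  where
  to′ : ∀ {ψ Δ} → Any (v ⊩_) (φ ∨f ψ ∷ Δ) → Any (v ⊩_) (φ ∷ ψ ∷ Δ)
  to′ {ψ} (here t) with to (T-∨ {⟦ φ ⟧ v} {⟦ ψ ⟧ v}) t
  ... | inj₁ t′ = here t′
  ... | inj₂ u = there (here u)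
  to′ (there r) = there (there r)
  from′ : ∀ {ψ Δ} → Any (v ⊩_) (φ ∷ ψ ∷ Δ) → Any (v ⊩_) (φ ∨f ψ ∷ Δ)
  from′ (here t) = here (from (T-∨ {⟦ φ ⟧ v}) (inj₁ t))
  from′ (there (here u)) = here (from (T-∨ {⟦ φ ⟧ v}) (inj₂ u))
  from′ (there (there r)) = there r

⊨*-∧ˡ : ∀ {φ ψ Γ Δ} → (φ ∧f ψ ∷ Γ) ⊨* Δ ⇔ (φ ∷ ψ ∷ Γ) ⊨* Δ
⊨*-∧ˡ = mk⇔ (λ e v → e v ∘ from All-⊩-∧) (λ e v → e v ∘ to All-⊩-∧)

⊨*-∨ʳ : ∀ {φ ψ Γ Δ} → Γ ⊨* (φ ∨f ψ ∷ Δ) ⇔ Γ ⊨* (φ ∷ ψ ∷ Δ)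
⊨*-∨ʳ = mk⇔ (λ e v → to Any-⊩-∨ ∘ e v) (λ e v → from Any-⊩-∨ ∘ e v)

⊨*-¬ˡ : ∀ {φ Γ Δ} → (¬f φ ∷ Γ) ⊨* Δ ⇔ Γ ⊨* (φ ∷ Δ)
⊨*-¬ˡ {φ} = mk⇔ to′
  (λ e v → λ { (n ∷ ts) → Any.tail (to (T-not⇔¬T (⟦ φ ⟧ v)) n) (e v ts) })
  where
  to′ : ∀ {Γ Δ} → (¬f φ ∷ Γ) ⊨* Δ → Γ ⊨* (φ ∷ Δ)
  to′ e v ts with T? (⟦ φ ⟧ v)
  ... | yes t = here t
  ... | no ¬t = there (e v (from (T-not⇔¬T (⟦ φ ⟧ v)) ¬t ∷ ts))

⊨*-¬ʳ : ∀ {φ Γ Δ} → Γ ⊨* (¬f φ ∷ Δ) ⇔ (φ ∷ Γ) ⊨* Δ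
⊨*-¬ʳ {φ} = mk⇔
  (λ e v → λ { (t ∷ ts) → Any.tail (λ n → to (T-not⇔¬T (⟦ φ ⟧ v)) n t) (e v ts) })
  from′
  where
  from′ : ∀ {Γ Δ} → (φ ∷ Γ) ⊨* Δ → Γ ⊨* (¬f φ ∷ Δ)
  from′ e v ts with T? (⟦ φ ⟧ v)
  ... | yes t = there (e v (t ∷ ts))
  ... | no ¬t = here (from (T-not⇔¬T (⟦ φ ⟧ v)) ¬t)

-- A partition (I , J) of the pairs of G, recorded by the list I of inputs Aᵢ (i ∈ I)
-- and the list J of outputs Xⱼ (j ∈ J).
data Partition : List Pair → List Formula → List Formula → Set where
  [] : Partition [] [] []
  inI : ∀ {G I J A X} → Partition G I J → Partition ((A , X) ∷ G) (A ∷ I) J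
  inJ : ∀ {G I J A X} → Partition G I J → Partition ((A , X) ∷ G) I (X ∷ J)

Partition-resp-↭ : ∀ {G G′ I J} → G ↭ G′ → Partition G I J →
                   ∃[ I′ ] ∃[ J′ ] Partition G′ I′ J′ × I′ ↭ I × J′ ↭ J
Partition-resp-↭ refl P = _ , _ , P , refl , refl
Partition-resp-↭ (prep _ G↭G′) (inI P) with Partition-resp-↭ G↭G′ P
... | _ , _ , P′ , I↭ , J↭ = _ , _ , inI P′ , prep _ I↭ , J↭
Partition-resp-↭ (prep _ G↭G′) (inJ P) with Partition-resp-↭ G↭G′ P
... | _ , _ , P′ , I↭ , J↭ = _ , _ , inJ P′ , I↭ , prep _ J↭
Partition-resp-↭ (swap _ _ G↭G′) (inI (inI P)) with Partition-resp-↭ G↭G′ P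
... | _ , _ , P′ , I↭ , J↭ = _ , _ , inI (inI P′) , swap _ _ I↭ , J↭
Partition-resp-↭ (swap _ _ G↭G′) (inI (inJ P)) with Partition-resp-↭ G↭G′ P
... | _ , _ , P′ , I↭ , J↭ = _ , _ , inJ (inI P′) , prep _ I↭ , prep _ J↭
Partition-resp-↭ (swap _ _ G↭G′) (inJ (inI P)) with Partition-resp-↭ G↭G′ P
... | _ , _ , P′ , I↭ , J↭ = _ , _ , inI (inJ P′) , prep _ I↭ , prep _ J↭
Partition-resp-↭ (swap _ _ G↭G′) (inJ (inJ P)) with Partition-resp-↭ G↭G′ P
... | _ , _ , P′ , I↭ , J↭ = _ , _ , inJ (inJ P′) , I↭ , swap _ _ J↭
Partition-resp-↭ (trans G↭G₁ G₁↭G′) P with Partition-resp-↭ G↭G₁ P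
... | _ , _ , P₁ , I₁↭ , J₁↭ with Partition-resp-↭ G₁↭G′ P₁
... | _ , _ , P′ , I′↭ , J′↭ = _ , _ , P′ , ↭-trans I′↭ I₁↭ , ↭-trans J′↭ J₁↭

infix 4 _⊨₄_

_⊨₄_ : List Pair → Pair → Set
G ⊨₄ (B , Y) = ∀ {I J} → Partition G I J → (B ∷ J) ⊨* I ⊎ J ⊨* (Y ∷ [])

⊨₄-resp-↭ : ∀ {G G′ BY} → G ↭ G′ → G ⊨₄ BY → G′ ⊨₄ BY
⊨₄-resp-↭ G↭G′ h P′ with Partition-resp-↭ (↭-sym G↭G′) P′
... | _ , _ , P , I↭I′ , J↭J′ =
  Sum.map (⊨*-resp-↭ (prep _ J↭J′) I↭I′) (⊨*-resp-↭ J↭J′ refl) (h P)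

⊨₄-∷ : ∀ {A X G B Y} →
       ((A , X) ∷ G) ⊨₄ (B , Y) ⇔ (G ⊨₄ (B ∧f ¬f A , Y) × G ⊨₄ (B ∧f X , Y ∨f ¬f X))
⊨₄-∷ {A} {X} {G} {B} {Y} = mk⇔
  (λ h → (λ {_ _} P → Sum.map₁ (from input-left) (h (inI P)))
       , (λ {_ _} P → Sum.map (from ⊨*-∧ˡ) (from output-right) (h (inJ P))))
  (λ { (h₁ , h₂) {_} {_} (inI P) → Sum.map₁ (to input-left) (h₁ P)
     ; (h₁ , h₂) {_} {_} (inJ P) → Sum.map (to ⊨*-∧ˡ) (to output-right) (h₂ P) })
  where
  input-left : ∀ {I J} → (B ∧f ¬f A ∷ J) ⊨* I ⇔ (B ∷ J) ⊨* (A ∷ I)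
  input-left = ⇔-trans ⊨*-∧ˡ (⇔-trans ⊨*-swapˡ ⊨*-¬ˡ)
  output-right : ∀ {J} → J ⊨* (Y ∨f ¬f X ∷ []) ⇔ (X ∷ J) ⊨* (Y ∷ [])
  output-right = ⇔-trans ⊨*-∨ʳ (⇔-trans ⊨*-swapʳ ⊨*-¬ʳ)

C4-sound : ∀ {G B Y} → C4⊢ G (B , Y) → G ⊨₄ (B , Y)
C4-sound (IN d) _ =
  inj₁ (⊨*-weaken (∷⁺ʳ _ (λ ())) (λ ()) (to (LK-derivable⇔⊨* {_ ∷ []} {[]}) d))
C4-sound (OUT d) _ =
  inj₂ (⊨*-weaken (λ ()) ⊆-refl (to (LK-derivable⇔⊨* {[]} {_ ∷ []}) d))
C4-sound (E4 G′↭ d₁ d₂) = ⊨₄-resp-↭ (↭-sym G′↭) (from ⊨₄-∷ (C4-sound d₁ , C4-sound d₂))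

C4-complete : ∀ G {B Y} → G ⊨₄ (B , Y) → C4⊢ G (B , Y)
C4-complete [] h = [ IN ∘ from LK-derivable⇔⊨* , OUT ∘ from LK-derivable⇔⊨* ] (h [])
C4-complete ((A , X) ∷ G) h =
  let (h₁ , h₂) = to ⊨₄-∷ h in E4 refl (C4-complete G h₁) (C4-complete G h₂)

foldr-tabulate : ∀ {B C : Set} n (g : Fin n → C) (k : C → B → B) e →
                 foldr k e (tabulate g) ≡ foldr (k ∘ g) e (allFin n)
foldr-tabulate n g k e =
  ≡-trans (cong (foldr k e) (sym (map-tabulate id g))) (foldr-map k g e (allFin n))

pairs-suc : ∀ n (A X : Fin (suc n) → Formula) →
            pairs (suc n) A X ≡ (A zero , X zero) ∷ pairs n (A ∘ suc) (X ∘ suc)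
pairs-suc n A X = cong ((A zero , X zero) ∷_)
  (≡-trans (map-tabulate suc (λ i → A i , X i))
           (sym (map-tabulate id (λ i → A (suc i) , X (suc i)))))

select-hit : ∀ {n} b (p : Fin (suc n) → Bool) f → p zero ≡ b →
             select b p f ≡ f zero ∷ select b (p ∘ suc) (f ∘ suc)
select-hit {n} true p f eq rewrite eq = cong (f zero ∷_) (foldr-tabulate n suc _ [])
select-hit {n} false p f eq rewrite eq = cong (f zero ∷_) (foldr-tabulate n suc _ [])

select-miss : ∀ {n} b (p : Fin (suc n) → Bool) f → p zero ≡ not b →
              select b p f ≡ select b (p ∘ suc) (f ∘ suc)
select-miss {n} true p f eq rewrite eq = foldr-tabulate n suc _ []
select-miss {n} false p f eq rewrite eq = foldr-tabulate n suc _ []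

Partition-cast : ∀ {G G′ I I′ J J′} → G ≡ G′ → I ≡ I′ → J ≡ J′ →
                 Partition G I J → Partition G′ I′ J′
Partition-cast refl refl refl P = P

select-partition : ∀ n (A X : Fin n → Formula) p →
                   Partition (pairs n A X) (select true p A) (select false p X)
select-partition zero A X p = []
select-partition (suc n) A X p =
  Partition-cast (sym (pairs-suc n A X)) refl refl (by-head (p zero) refl)
  where
  rest : Partition (pairs n (A ∘ suc) (X ∘ suc))
                   (select true (p ∘ suc) (A ∘ suc)) (select false (p ∘ suc) (X ∘ suc))
  rest = select-partition n (A ∘ suc) (X ∘ suc) (p ∘ suc)
  by-head : ∀ b → p zero ≡ b →
            Partition ((A zero , X zero) ∷ pairs n (A ∘ suc) (X ∘ suc))
                      (select true p A) (select false p X)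
  by-head true eq =
    Partition-cast refl (sym (select-hit true p A eq)) (sym (select-miss false p X eq)) (inI rest)
  by-head false eq =
    Partition-cast refl (sym (select-miss true p A eq)) (sym (select-hit false p X eq)) (inJ rest)

partition-select : ∀ n (A X : Fin n → Formula) {I J} → Partition (pairs n A X) I J →
                   ∃[ p ] I ≡ select true p A × J ≡ select false p X
partition-select zero A X [] = (λ ()) , refl , refl
partition-select (suc n) A X {I} {J} P
  with subst (λ G → Partition G I J) (pairs-suc n A X) P
... | inI P′ with partition-select n (A ∘ suc) (X ∘ suc) P′
...   | p , refl , refl = true ◂ p
                        , sym (select-hit true (true ◂ p) A refl)
                        , sym (select-miss false (true ◂ p) X refl)
partition-select (suc n) A X {I} {J} P
    | inJ P′ with partition-select n (A ∘ suc) (X ∘ suc) P′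
...   | p , refl , refl = false ◂ p
                        , sym (select-miss true (false ◂ p) A refl)
                        , sym (select-hit false (false ◂ p) X refl)

⊨₄-pairs : ∀ n (A X : Fin n → Formula) B Y →
           pairs n A X ⊨₄ (B , Y)
           ⇔ (∀ p → LK-derivable ((B ∷ select false p X) ⇒ select true p A)
                    ⊎ LK-derivable (select false p X ⇒ (Y ∷ [])))
⊨₄-pairs n A X B Y = mk⇔ to′ from′
  where
  Selected : (Fin n → Bool) → Set
  Selected p = LK-derivable ((B ∷ select false p X) ⇒ select true p A)
               ⊎ LK-derivable (select false p X ⇒ (Y ∷ []))
  to′ : pairs n A X ⊨₄ (B , Y) → ∀ p → Selected p
  to′ h p = from (LK-derivable⇔⊨* ⊎-⇔ LK-derivable⇔⊨*) (h (select-partition n A X p))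
  by-selection : ∀ {I J} → (∀ p → Selected p) →
    ∃[ p ] I ≡ select true p A × J ≡ select false p X → (B ∷ J) ⊨* I ⊎ J ⊨* (Y ∷ [])
  by-selection h (p , refl , refl) = to (LK-derivable⇔⊨* ⊎-⇔ LK-derivable⇔⊨*) (h p)
  from′ : (∀ p → Selected p) → pairs n A X ⊨₄ (B , Y)
  from′ h P = by-selection h (partition-select n A X P)

lemma4 : ∀ (n : ℕ) (A X : Fin n → Formula) (B Y : Formula) →
    C4⊢ (pairs n A X) (B , Y)
    ⇔ (∀ (p : Fin n → Bool) →
        LK-derivable ((B ∷ select false p X) ⇒ select true p A)
        ⊎ LK-derivable (select false p X ⇒ (Y ∷ [])))
lemma4 n A X B Y = ⇔-trans (mk⇔ C4-sound (C4-complete _)) (⊨₄-pairs n A X B Y)
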